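{- For all sufficiently large $n$ the following holds. Let $t=n^{2/3}/100$ and $l=\lfloor n^{1/3}\rfloor$. Suppose $n$ cubes, each labeled by a number from $\{1,\dots,a\}$ (for some positive integer $a$), are arranged in $m$ vertical stacks, each stack containing between $t$ and $3t$ cubes, and such that for every $i\in\{1,\dots,a\}$ the total number of cubes labeled $i$ is at most $t$. In each stack, choose a consecutive substack of $l$ cubes uniformly at random, independently across stacks. Then with positive probability, for every $i\in\{1,\dots,a\}$, fewer than $m/10$ of the chosen substacks contain a cube labeled $i$.
   Context: A consecutive substack of length $l$ of a stack is a set of $l$ cubes occupying consecutive positions in that stack. -}

module Defs where

open import Data.Nat using (ℕ; zero; suc; _+_; _*_; _^_; _≤_; _<_)
open import Data.Fin using (Fin; zero; suc)
open import Data.Fin.Properties using (_≟_)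
open import Data.Bool using (Bool; true; false; if_then_else_; _∨_)
open import Data.List using (List; []; _∷_; length; take; drop)
open import Data.Product using (Σ)
open import Relation.Nullary.Decidable using (⌊_⌋)

-- A stack is a list of cube labels, bottom to top; labels 1..a are Fin a.
Stack : ℕ → Set
Stack a = List (Fin a)

countLabel : ∀ {a} → Fin a → Stack a → ℕ
countLabel i [] = 0
countLabel i (x ∷ xs) = (if ⌊ i ≟ x ⌋ then 1 else 0) + countLabel i xs

hasLabel : ∀ {a} → Fin a → Stack a → Bool
hasLabel i [] = false
hasLabel i (x ∷ xs) = ⌊ i ≟ x ⌋ ∨ hasLabel i xs

sumFin : (m : ℕ) → (Fin m → ℕ) → ℕ
sumFin zero f = 0
sumFin (suc m) f = f zero + sumFin m (λ j → f (suc j))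

countFin : (m : ℕ) → (Fin m → Bool) → ℕ
countFin m p = sumFin m (λ j → if p j then 1 else 0)

substack : ∀ {a} → ℕ → ℕ → Stack a → Stack a
substack k l xs = take l (drop k xs)

SubstackChoice : ∀ {a} → ℕ → Stack a → Set
SubstackChoice l xs = Σ ℕ (λ k → k + l ≤ length xs)

-- Cut each stack into B = 2k disjoint blocks of length l, where k = ⌊l/200⌋, and choose one block
-- per stack. For a label i with total count c_i consider the potential c_i ∏_j 2^[i occurs in the
-- chosen block of stack j]. Averaged over all choices it is c_i ∏_j (1 + h_ij/B), where h_ij is the
-- number of blocks of stack j containing i; since ∑_j h_ij ≤ c_i ≤ C = kq this is at most
-- c_i (1 + 1/B)^C ≤ c_i 2^q. By the method of conditional expectations some choice keeps the sum of
-- the potentials below (∑_i c_i) 2^q = n 2^q < 2^(3l) (q = 2l + 1000), so every label occurs in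
-- fewer than 3l chosen blocks, whereas there are at least 30l stacks.
module Submission where

open import Data.Bool using (Bool; true; false; if_then_else_)
open import Data.Fin using (Fin; zero; suc; toℕ)
open import Data.Fin.Properties using (_≟_; toℕ<n)
open import Data.List using ([]; _∷_; length; take; drop)
open import Data.List.Properties using (drop-drop)
open import Data.Nat using (ℕ; zero; suc; _+_; _*_; _^_; _∸_; _≤_; _<_; z≤n; s≤s; NonZero; >-nonZero)
open import Data.Nat.Properties hiding (_≟_)
open import Algebra.Properties.CommutativeSemigroup +-commutativeSemigroup
  using () renaming (interchange to +-interchange)
open import Algebra.Properties.CommutativeSemigroup *-commutativeSemigroup
  using () renaming (interchange to *-interchange; x∙yz≈y∙xz to *-left-comm)
open import Data.Nat.DivMod using (_/_; _%_; m/n*n≤m; m≡m%n+[m/n]*n; m%n<n; /-monoˡ-≤)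
open import Data.Nat.Tactic.RingSolver using (solve-∀)
open import Data.Product using (Σ; ∃; proj₁; proj₂; _×_; _,_)
open import Data.Unit using (tt)
open import Relation.Binary.PropositionalEquality
open import Relation.Nullary using (yes; no; contradiction)
open import Relation.Nullary.Decidable using (⌊_⌋)

open import Defs

∀-offset⇒∀-≥ : ∀ {P : ℕ → Set} K → (∀ x → P (x + K)) → ∀ {l} → K ≤ l → P l
∀-offset⇒∀-≥ {P} K p {l} K≤l = subst P (m∸n+n≡m K≤l) (p (l ∸ K))

^-distribʳ-* : ∀ x y n → (x * y) ^ n ≡ x ^ n * y ^ n
^-distribʳ-* x y zero    = refl
^-distribʳ-* x y (suc n) = trans (cong (x * y *_) (^-distribʳ-* x y n)) (*-interchange x y (x ^ n) (y ^ n))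

^-cancelˡ-≤ : ∀ n .{{_ : NonZero n}} {x y} → x ^ n ≤ y ^ n → x ≤ y
^-cancelˡ-≤ n {x} {y} xⁿ≤yⁿ with x ≤? y
... | yes x≤y = x≤y
... | no  x≰y = contradiction xⁿ≤yⁿ (<⇒≱ (^-monoˡ-< n (≰⇒> x≰y)))

^-cancelˡ-< : ∀ n {x y} → x ^ n < y ^ n → x < y
^-cancelˡ-< n {x} {y} xⁿ<yⁿ with x <? y
... | yes x<y = x<y
... | no  x≮y = contradiction xⁿ<yⁿ (≤⇒≯ (^-monoˡ-≤ n (≮⇒≥ x≮y)))

^-cancelʳ-< : ∀ b .{{_ : NonZero b}} {x y} → b ^ x < b ^ y → x < y
^-cancelʳ-< b {x} {y} bˣ<bʸ with x <? y
... | yes x<y = x<y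
... | no  x≮y = contradiction bˣ<bʸ (≤⇒≯ (^-monoʳ-≤ b (≮⇒≥ x≮y)))

[x^2]^3≡[x^3]^2 : ∀ x → (x ^ 2) ^ 3 ≡ (x ^ 3) ^ 2
[x^2]^3≡[x^3]^2 x = trans (^-*-assoc x 2 3) (sym (^-*-assoc x 3 2))

prodFin : (m : ℕ) → (Fin m → ℕ) → ℕ
prodFin zero    f = 1
prodFin (suc m) f = f zero * prodFin m (λ j → f (suc j))

indicator : Bool → ℕ
indicator b = if b then 1 else 0

sumFin-cong : ∀ m {f g : Fin m → ℕ} → (∀ j → f j ≡ g j) → sumFin m f ≡ sumFin m g
sumFin-cong zero    f≡g = refl
sumFin-cong (suc m) f≡g = cong₂ _+_ (f≡g zero) (sumFin-cong m (λ j → f≡g (suc j)))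

prodFin-cong : ∀ m {f g : Fin m → ℕ} → (∀ j → f j ≡ g j) → prodFin m f ≡ prodFin m g
prodFin-cong zero    f≡g = refl
prodFin-cong (suc m) f≡g = cong₂ _*_ (f≡g zero) (prodFin-cong m (λ j → f≡g (suc j)))

sumFin-mono : ∀ m {f g : Fin m → ℕ} → (∀ j → f j ≤ g j) → sumFin m f ≤ sumFin m g
sumFin-mono zero    f≤g = z≤n
sumFin-mono (suc m) f≤g = +-mono-≤ (f≤g zero) (sumFin-mono m (λ j → f≤g (suc j)))

sumFin-const : ∀ m c → sumFin m (λ _ → c) ≡ m * c
sumFin-const zero    c = refl
sumFin-const (suc m) c = cong (c +_) (sumFin-const m c)

sumFin-+ : ∀ m (f g : Fin m → ℕ) → sumFin m (λ j → f j + g j) ≡ sumFin m f + sumFin m g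
sumFin-+ zero    f g = refl
sumFin-+ (suc m) f g =
  trans (cong (f zero + g zero +_) (sumFin-+ m (λ j → f (suc j)) (λ j → g (suc j))))
        (+-interchange (f zero) (g zero) _ _)

sumFin-suc : ∀ m (f : Fin m → ℕ) → sumFin m (λ j → suc (f j)) ≡ m + sumFin m f
sumFin-suc m f = trans (sumFin-+ m (λ _ → 1) f) (cong (_+ sumFin m f) (trans (sumFin-const m 1) (*-identityʳ m)))

sumFin-*ˡ : ∀ m c (f : Fin m → ℕ) → sumFin m (λ j → c * f j) ≡ c * sumFin m f
sumFin-*ˡ zero    c f = sym (*-zeroʳ c)
sumFin-*ˡ (suc m) c f =
  trans (cong (c * f zero +_) (sumFin-*ˡ m c (λ j → f (suc j)))) (sym (*-distribˡ-+ c (f zero) _))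

sumFin-*ʳ : ∀ m c (f : Fin m → ℕ) → sumFin m (λ j → f j * c) ≡ sumFin m f * c
sumFin-*ʳ m c f =
  trans (sumFin-cong m (λ j → *-comm (f j) c)) (trans (sumFin-*ˡ m c f) (*-comm c (sumFin m f)))

sumFin-comm : ∀ m k (g : Fin m → Fin k → ℕ) →
  sumFin m (λ j → sumFin k (g j)) ≡ sumFin k (λ i → sumFin m (λ j → g j i))
sumFin-comm zero    k g = sym (trans (sumFin-const k 0) (*-zeroʳ k))
sumFin-comm (suc m) k g =
  trans (cong (sumFin k (g zero) +_) (sumFin-comm m k (λ j → g (suc j))))
        (sym (sumFin-+ k (g zero) _))

sumFin-≤-* : ∀ m {c} {f : Fin m → ℕ} → (∀ j → f j ≤ c) → sumFin m f ≤ m * c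
sumFin-≤-* m {c} f≤c = subst (_ ≤_) (sumFin-const m c) (sumFin-mono m f≤c)

≤-sumFin : ∀ m (f : Fin m → ℕ) j → f j ≤ sumFin m f
≤-sumFin (suc m) f zero    = m≤m+n _ _
≤-sumFin (suc m) f (suc j) = ≤-trans (≤-sumFin m (λ j → f (suc j)) j) (m≤n+m _ _)

prodFin-2^countFin : ∀ m (p : Fin m → Bool) → prodFin m (λ j → suc (indicator (p j))) ≡ 2 ^ countFin m p
prodFin-2^countFin zero    p = refl
prodFin-2^countFin (suc m) p with p zero
... | true  = cong (2 *_) (prodFin-2^countFin m (λ j → p (suc j)))
... | false = trans (+-identityʳ _) (prodFin-2^countFin m (λ j → p (suc j)))

-- The method of conditional expectations

∃-≤-average : ∀ B .{{_ : NonZero B}} (F : Fin B → ℕ) → ∃ λ b → B * F b ≤ sumFin B F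
∃-≤-average (suc zero)    F = zero , ≤-refl
∃-≤-average (suc (suc B)) F with ∃-≤-average (suc B) (λ b → F (suc b))
... | b , avg with F zero ≤? F (suc b)
...   | yes F₀≤F = zero  , +-monoʳ-≤ (F zero) (≤-trans (*-monoʳ-≤ (suc B) F₀≤F) avg)
...   | no  F₀≰F = suc b , +-mono-≤ (<⇒≤ (≰⇒> F₀≰F)) avg

-- The right-hand side is the sum of the potential over all B ^ m choices c.
∃-choice-≤-average-potential : ∀ {a} m B .{{_ : NonZero B}}
  (f : Fin m → Fin B → Fin a → ℕ) (w : Fin a → ℕ) →
  ∃ λ (c : Fin m → Fin B) →
    B ^ m * sumFin a (λ i → w i * prodFin m (λ j → f j (c j) i))
      ≤ sumFin a (λ i → w i * prodFin m (λ j → sumFin B (λ b → f j b i)))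
∃-choice-≤-average-potential zero B f w = (λ ()) , ≤-reflexive (+-identityʳ _)
∃-choice-≤-average-potential {a} (suc m) B f w = c , bound
  where
  rest : Fin a → ℕ
  rest i = prodFin m (λ j → sumFin B (λ b → f (suc j) b i))

  F : Fin B → ℕ
  F b = sumFin a (λ i → (w i * f zero b i) * rest i)

  b₀ = proj₁ (∃-≤-average B F)
  ih = ∃-choice-≤-average-potential m B (λ j → f (suc j)) (λ i → w i * f zero b₀ i)

  c : Fin (suc m) → Fin B
  c zero    = b₀
  c (suc j) = proj₁ ih j

  sumFin-F : sumFin B F ≡ sumFin a (λ i → w i * (sumFin B (λ b → f zero b i) * rest i))
  sumFin-F = trans (sumFin-comm B a _) (sumFin-cong a λ i → begin
    sumFin B (λ b → w i * f zero b i * rest i)    ≡⟨ sumFin-*ʳ B (rest i) _ ⟩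
    sumFin B (λ b → w i * f zero b i) * rest i    ≡⟨ cong (_* rest i) (sumFin-*ˡ B (w i) _) ⟩
    w i * sumFin B (λ b → f zero b i) * rest i    ≡⟨ *-assoc (w i) _ (rest i) ⟩
    w i * (sumFin B (λ b → f zero b i) * rest i)  ∎)
    where open ≡-Reasoning

  bound : B ^ suc m * sumFin a (λ i → w i * prodFin (suc m) (λ j → f j (c j) i))
            ≤ sumFin a (λ i → w i * prodFin (suc m) (λ j → sumFin B (λ b → f j b i)))
  bound = begin
    B * B ^ m * sumFin a (λ i → w i * (f zero b₀ i * _))
      ≡⟨ *-assoc B (B ^ m) _ ⟩
    B * (B ^ m * sumFin a (λ i → w i * (f zero b₀ i * _)))
      ≡⟨ cong (λ s → B * (B ^ m * s)) (sumFin-cong a (λ i → sym (*-assoc (w i) _ _))) ⟩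
    B * (B ^ m * sumFin a (λ i → w i * f zero b₀ i * _))
      ≤⟨ *-monoʳ-≤ B (proj₂ ih) ⟩
    B * F b₀
      ≤⟨ proj₂ (∃-≤-average B F) ⟩
    sumFin B F
      ≡⟨ sumFin-F ⟩
    _ ∎
    where open ≤-Reasoning

-- Bernoulli-type estimates

bernoulli : ∀ b h → (b + h) * b ^ h ≤ b * suc b ^ h
bernoulli b zero    = ≤-reflexive (cong (_* 1) (+-identityʳ b))
bernoulli b (suc h) = begin
  (b + suc h) * (b * b ^ h)        ≡⟨ expand b h (b ^ h) ⟩
  b * ((b + h) * b ^ h + b ^ h)    ≤⟨ *-monoʳ-≤ b (+-mono-≤ (bernoulli b h) (^-monoˡ-≤ h (n≤1+n b))) ⟩
  b * (b * suc b ^ h + suc b ^ h)  ≡⟨ cong (b *_) (+-comm (b * suc b ^ h) _) ⟩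
  b * (suc b * suc b ^ h)          ∎
  where
  open ≤-Reasoning
  expand : ∀ b h x → (b + suc h) * (b * x) ≡ b * ((b + h) * x + x)
  expand = solve-∀

prodFin-bernoulli-sumFin : ∀ m b (h : Fin m → ℕ) →
  prodFin m (λ j → b + h j) * b ^ sumFin m h ≤ b ^ m * suc b ^ sumFin m h
prodFin-bernoulli-sumFin zero    b h = ≤-refl
prodFin-bernoulli-sumFin (suc m) b h = begin
  (b + h₀) * P * b ^ (h₀ + S)            ≡⟨ cong ((b + h₀) * P *_) (^-distribˡ-+-* b h₀ S) ⟩
  (b + h₀) * P * (b ^ h₀ * b ^ S)        ≡⟨ *-interchange (b + h₀) P _ _ ⟩
  (b + h₀) * b ^ h₀ * (P * b ^ S)        ≤⟨ *-mono-≤ (bernoulli b h₀) (prodFin-bernoulli-sumFin m b h′) ⟩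
  b * suc b ^ h₀ * (b ^ m * suc b ^ S)   ≡⟨ *-interchange b (suc b ^ h₀) _ _ ⟩
  b * b ^ m * (suc b ^ h₀ * suc b ^ S)   ≡⟨ cong (b * b ^ m *_) (sym (^-distribˡ-+-* (suc b) h₀ S)) ⟩
  b * b ^ m * suc b ^ (h₀ + S)           ∎
  where
  open ≤-Reasoning
  h₀ = h zero
  h′ = λ j → h (suc j)
  S = sumFin m h′
  P = prodFin m (λ j → b + h′ j)

prodFin-bernoulli : ∀ m b (h : Fin m → ℕ) C → sumFin m h ≤ C →
  prodFin m (λ j → b + h j) * b ^ C ≤ b ^ m * suc b ^ C
prodFin-bernoulli m b h C S≤C = subst (λ C → P * b ^ C ≤ b ^ m * suc b ^ C) (m+[n∸m]≡n S≤C) (begin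
  P * b ^ (S + d)                  ≡⟨ cong (P *_) (^-distribˡ-+-* b S d) ⟩
  P * (b ^ S * b ^ d)              ≡⟨ *-assoc P _ _ ⟨
  P * b ^ S * b ^ d                ≤⟨ *-mono-≤ (prodFin-bernoulli-sumFin m b h) (^-monoˡ-≤ d (n≤1+n b)) ⟩
  b ^ m * suc b ^ S * suc b ^ d    ≡⟨ *-assoc (b ^ m) _ _ ⟩
  b ^ m * (suc b ^ S * suc b ^ d)  ≡⟨ cong (b ^ m *_) (^-distribˡ-+-* (suc b) S d) ⟨
  b ^ m * suc b ^ (S + d)          ∎)
  where
  open ≤-Reasoning
  S = sumFin m h
  P = prodFin m (λ j → b + h j)
  d = C ∸ S

-- Subtraction-free form of (1 + 1/B)^k (1 - k/B) ≤ 1 for B = k + d.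
[1+k+d]^k*d≤[k+d]^[1+k] : ∀ k d → suc (k + d) ^ k * d ≤ (k + d) ^ suc k
[1+k+d]^k*d≤[k+d]^[1+k] zero    d = ≤-reflexive (trans (+-identityʳ d) (sym (*-identityʳ d)))
[1+k+d]^k*d≤[k+d]^[1+k] (suc k) d = begin
  suc B * suc B ^ k * d    ≡⟨ *-assoc (suc B) (suc B ^ k) d ⟩
  suc B * (suc B ^ k * d)  ≡⟨ *-left-comm (suc B) (suc B ^ k) d ⟩
  suc B ^ k * (suc B * d)  ≤⟨ *-monoʳ-≤ (suc B ^ k) (+-mono-≤ (m≤n+m d (suc k)) (≤-reflexive (*-comm B d))) ⟩
  suc B ^ k * (suc d * B)  ≡⟨ *-assoc (suc B ^ k) (suc d) B ⟨
  suc B ^ k * suc d * B    ≤⟨ *-monoˡ-≤ B ih ⟩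
  B ^ suc k * B            ≡⟨ *-comm (B ^ suc k) B ⟩
  B * B ^ suc k            ∎
  where
  open ≤-Reasoning
  B = suc k + d
  ih : suc B ^ k * suc d ≤ B ^ suc k
  ih = subst (λ B → suc B ^ k * suc d ≤ B ^ suc k) (+-suc k d) ([1+k+d]^k*d≤[k+d]^[1+k] k (suc d))

[1+2k]^k≤2*[2k]^k : ∀ k .{{_ : NonZero k}} → suc (2 * k) ^ k ≤ 2 * (2 * k) ^ k
[1+2k]^k≤2*[2k]^k k = *-cancelʳ-≤ _ _ k (begin
  suc (2 * k) ^ k * k      ≡⟨ cong (λ B → suc B ^ k * k) 2k≡k+k ⟩
  suc (k + k) ^ k * k      ≤⟨ [1+k+d]^k*d≤[k+d]^[1+k] k k ⟩
  (k + k) * (k + k) ^ k    ≡⟨ cong (λ B → B * B ^ k) 2k≡k+k ⟨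
  2 * k * (2 * k) ^ k      ≡⟨ *-assoc 2 k _ ⟩
  2 * (k * (2 * k) ^ k)    ≡⟨ cong (2 *_) (*-comm k _) ⟩
  2 * ((2 * k) ^ k * k)    ≡⟨ *-assoc 2 ((2 * k) ^ k) k ⟨
  2 * (2 * k) ^ k * k      ∎)
  where
  open ≤-Reasoning
  2k≡k+k : 2 * k ≡ k + k
  2k≡k+k = cong (k +_) (+-identityʳ k)

[1+2k]^[k*q]≤2^q*[2k]^[k*q] : ∀ k q .{{_ : NonZero k}} → suc (2 * k) ^ (k * q) ≤ 2 ^ q * (2 * k) ^ (k * q)
[1+2k]^[k*q]≤2^q*[2k]^[k*q] k q = begin
  suc (2 * k) ^ (k * q)       ≡⟨ ^-*-assoc _ k q ⟨
  (suc (2 * k) ^ k) ^ q       ≤⟨ ^-monoˡ-≤ q ([1+2k]^k≤2*[2k]^k k) ⟩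
  (2 * (2 * k) ^ k) ^ q       ≡⟨ ^-distribʳ-* 2 _ q ⟩
  2 ^ q * ((2 * k) ^ k) ^ q   ≡⟨ cong (2 ^ q *_) (^-*-assoc _ k q) ⟩
  2 ^ q * (2 * k) ^ (k * q)   ∎
  where open ≤-Reasoning

-- Derandomised choice of one of 2k alternatives per row

∃-choice-with-few-hits : ∀ {a} m k q .{{_ : NonZero k}}
  (hit : Fin m → Fin (2 * k) → Fin a → Bool) (w : Fin a → ℕ) →
  (∀ i → sumFin m (λ j → countFin (2 * k) (λ b → hit j b i)) ≤ k * q) →
  ∃ λ (c : Fin m → Fin (2 * k)) →
    ∀ i → w i * 2 ^ countFin m (λ j → hit j (c j) i) ≤ sumFin a w * 2 ^ q
∃-choice-with-few-hits {a} m k q hit w mass≤ = c , few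
  where
  B = 2 * k
  C = k * q
  D = B ^ m * B ^ C
  instance
    B≢0 : NonZero B
    B≢0 = m*n≢0 2 k
    D≢0 : NonZero D
    D≢0 = m*n≢0 (B ^ m) (B ^ C) {{m^n≢0 B m}} {{m^n≢0 B C}}

  f : Fin m → Fin B → Fin a → ℕ
  f j b i = suc (indicator (hit j b i))

  average = ∃-choice-≤-average-potential m B f w
  c = proj₁ average

  potential : Fin a → ℕ
  potential i = prodFin m (λ j → sumFin B (λ b → f j b i))

  chosen-potential : ℕ
  chosen-potential = sumFin a (λ i → w i * prodFin m (λ j → f j (c j) i))

  potential-bound : ∀ i → potential i * B ^ C ≤ 2 ^ q * D
  potential-bound i = begin
    potential i * B ^ C
      ≡⟨ cong (_* B ^ C) (prodFin-cong m (λ j → sumFin-suc B _)) ⟩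
    prodFin m (λ j → B + countFin B (λ b → hit j b i)) * B ^ C
      ≤⟨ prodFin-bernoulli m B _ C (mass≤ i) ⟩
    B ^ m * suc B ^ C
      ≤⟨ *-monoʳ-≤ (B ^ m) ([1+2k]^[k*q]≤2^q*[2k]^[k*q] k q) ⟩
    B ^ m * (2 ^ q * B ^ C)
      ≡⟨ *-left-comm (B ^ m) (2 ^ q) _ ⟩
    2 ^ q * D ∎
    where open ≤-Reasoning

  few : ∀ i → w i * 2 ^ countFin m (λ j → hit j (c j) i) ≤ sumFin a w * 2 ^ q
  few i = *-cancelʳ-≤ _ _ D (begin
    w i * 2 ^ countFin m (λ j → hit j (c j) i) * D
      ≡⟨ cong (λ p → w i * p * D) (prodFin-2^countFin m (λ j → hit j (c j) i)) ⟨
    w i * prodFin m (λ j → f j (c j) i) * D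
      ≤⟨ *-monoˡ-≤ D (≤-sumFin a (λ i → w i * prodFin m (λ j → f j (c j) i)) i) ⟩
    chosen-potential * D
      ≡⟨ *-left-comm chosen-potential (B ^ m) (B ^ C) ⟩
    B ^ m * (chosen-potential * B ^ C)
      ≡⟨ *-assoc (B ^ m) _ _ ⟨
    B ^ m * chosen-potential * B ^ C
      ≤⟨ *-monoˡ-≤ (B ^ C) (proj₂ average) ⟩
    sumFin a (λ i → w i * potential i) * B ^ C
      ≡⟨ sumFin-*ʳ a (B ^ C) _ ⟨
    sumFin a (λ i → w i * potential i * B ^ C)
      ≤⟨ sumFin-mono a (λ i → ≤-trans (≤-reflexive (*-assoc (w i) _ _))
                                      (*-monoʳ-≤ (w i) (potential-bound i))) ⟩
    sumFin a (λ i → w i * (2 ^ q * D))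
      ≡⟨ sumFin-*ʳ a (2 ^ q * D) w ⟩
    sumFin a w * (2 ^ q * D)
      ≡⟨ *-assoc (sumFin a w) _ _ ⟨
    sumFin a w * 2 ^ q * D ∎)
    where open ≤-Reasoning

countLabel-take-drop : ∀ {a} (i : Fin a) l (xs : Stack a) →
  countLabel i xs ≡ countLabel i (take l xs) + countLabel i (drop l xs)
countLabel-take-drop i zero    xs       = refl
countLabel-take-drop i (suc l) []       = refl
countLabel-take-drop i (suc l) (x ∷ xs) =
  trans (cong (indicator ⌊ i ≟ x ⌋ +_) (countLabel-take-drop i l xs)) (sym (+-assoc (indicator ⌊ i ≟ x ⌋) _ _))

hasLabel≤countLabel : ∀ {a} (i : Fin a) (xs : Stack a) → indicator (hasLabel i xs) ≤ countLabel i xs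
hasLabel≤countLabel i []       = z≤n
hasLabel≤countLabel i (x ∷ xs) with ⌊ i ≟ x ⌋
... | true  = s≤s z≤n
... | false = hasLabel≤countLabel i xs

countLabel-substack≤ : ∀ {a} (i : Fin a) k l (xs : Stack a) → countLabel i (substack k l xs) ≤ countLabel i xs
countLabel-substack≤ i k l xs = begin
  countLabel i (take l (drop k xs))                                     ≤⟨ m≤m+n _ _ ⟩
  countLabel i (take l (drop k xs)) + countLabel i (drop l (drop k xs)) ≡⟨ countLabel-take-drop i l (drop k xs) ⟨
  countLabel i (drop k xs)                                              ≤⟨ m≤n+m _ _ ⟩
  countLabel i (take k xs) + countLabel i (drop k xs)                   ≡⟨ countLabel-take-drop i k xs ⟨
  countLabel i xs                                                       ∎
  where open ≤-Reasoning

countFin-blocks≤countLabel : ∀ {a} (i : Fin a) l B (xs : Stack a) →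
  countFin B (λ b → hasLabel i (substack (toℕ b * l) l xs)) ≤ countLabel i xs
countFin-blocks≤countLabel i l zero    xs = z≤n
countFin-blocks≤countLabel i l (suc B) xs = begin
  indicator (hasLabel i (take l xs)) + countFin B (λ b → hasLabel i (take l (drop (l + toℕ b * l) xs)))
    ≡⟨ cong (indicator (hasLabel i (take l xs)) +_)
         (sumFin-cong B (λ b → cong (λ ys → indicator (hasLabel i (take l ys))) (drop-drop l (toℕ b * l) xs))) ⟨
  indicator (hasLabel i (take l xs)) + countFin B (λ b → hasLabel i (substack (toℕ b * l) l (drop l xs)))
    ≤⟨ +-mono-≤ (hasLabel≤countLabel i (take l xs)) (countFin-blocks≤countLabel i l B (drop l xs)) ⟩
  countLabel i (take l xs) + countLabel i (drop l xs)
    ≡⟨ countLabel-take-drop i l xs ⟨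
  countLabel i xs ∎
  where open ≤-Reasoning

sumFin-indicator-≟ : ∀ {a} (x : Fin a) → sumFin a (λ i → indicator ⌊ i ≟ x ⌋) ≡ 1
sumFin-indicator-≟ {suc a} zero    = cong suc (trans (sumFin-const a 0) (*-zeroʳ a))
sumFin-indicator-≟ {suc a} (suc x) = trans (sumFin-cong a (λ j → cong indicator (≟-suc j))) (sumFin-indicator-≟ x)
  where
  ≟-suc : ∀ j → ⌊ Fin.suc j ≟ suc x ⌋ ≡ ⌊ j ≟ x ⌋
  ≟-suc j with j ≟ x
  ... | yes _ = refl
  ... | no  _ = refl

sumFin-countLabel : ∀ a (xs : Stack a) → sumFin a (λ i → countLabel i xs) ≡ length xs
sumFin-countLabel a []       = trans (sumFin-const a 0) (*-zeroʳ a)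
sumFin-countLabel a (x ∷ xs) =
  trans (sumFin-+ a (λ i → indicator ⌊ i ≟ x ⌋) (λ i → countLabel i xs))
        (cong₂ _+_ (sumFin-indicator-≟ x) (sumFin-countLabel a xs))

labelTotal : ∀ {a m} → (Fin m → Stack a) → Fin a → ℕ
labelTotal {m = m} stacks i = sumFin m (λ j → countLabel i (stacks j))

hits : ∀ {a m} l (stacks : Fin m → Stack a) → ((j : Fin m) → SubstackChoice l (stacks j)) → Fin a → ℕ
hits {m = m} l stacks choice i = countFin m (λ j → hasLabel i (substack (proj₁ (choice j)) l (stacks j)))

hits≤labelTotal : ∀ {a m} l (stacks : Fin m → Stack a) choice (i : Fin a) →
  hits l stacks choice i ≤ labelTotal stacks i
hits≤labelTotal {m = m} l stacks choice i = sumFin-mono m λ j →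
  let k = proj₁ (choice j) in
  ≤-trans (hasLabel≤countLabel i (substack k l (stacks j))) (countLabel-substack≤ i k l (stacks j))

sumFin-labelTotal : ∀ {a m} (stacks : Fin m → Stack a) →
  sumFin a (labelTotal stacks) ≡ sumFin m (λ j → length (stacks j))
sumFin-labelTotal {a} {m} stacks =
  trans (sym (sumFin-comm m a (λ j i → countLabel i (stacks j))))
        (sumFin-cong m (λ j → sumFin-countLabel a (stacks j)))

block-fits : ∀ {B} l (b : Fin B) {L} → B * l ≤ L → toℕ b * l + l ≤ L
block-fits l b Bl≤L = ≤-trans (≤-reflexive (+-comm _ l)) (≤-trans (*-monoˡ-≤ l (toℕ<n b)) Bl≤L)

∃-substacks-with-few-hits : ∀ {a m n} l k q .{{_ : NonZero k}} (stacks : Fin m → Stack a) →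
  sumFin m (λ j → length (stacks j)) ≡ n →
  (∀ j → 2 * k * l ≤ length (stacks j)) →
  (∀ i → labelTotal stacks i ≤ k * q) →
  Σ ((j : Fin m) → SubstackChoice l (stacks j)) λ choice →
    ∀ i → labelTotal stacks i * 2 ^ hits l stacks choice i ≤ n * 2 ^ q
∃-substacks-with-few-hits {a} {m} {n} l k q stacks size≡n fits total≤ = choice , few
  where
  hit : Fin m → Fin (2 * k) → Fin a → Bool
  hit j b i = hasLabel i (substack (toℕ b * l) l (stacks j))

  mass≤ : ∀ i → sumFin m (λ j → countFin (2 * k) (λ b → hit j b i)) ≤ k * q
  mass≤ i = ≤-trans (sumFin-mono m (λ j → countFin-blocks≤countLabel i l (2 * k) (stacks j))) (total≤ i)

  chosen = ∃-choice-with-few-hits m k q hit (labelTotal stacks) mass≤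

  choice : (j : Fin m) → SubstackChoice l (stacks j)
  choice j = toℕ (proj₁ chosen j) * l , block-fits l (proj₁ chosen j) (fits j)

  few : ∀ i → labelTotal stacks i * 2 ^ hits l stacks choice i ≤ n * 2 ^ q
  few i = subst (λ W → labelTotal stacks i * 2 ^ hits l stacks choice i ≤ W * 2 ^ q)
                (trans (sumFin-labelTotal stacks) size≡n) (proj₂ chosen i)

-- Numerical estimates for the parameters l = ⌊n^(1/3)⌋, k = ⌊l/200⌋ and q = 2l + 1000

l/200-bounds : ∀ l → 400 ≤ l → 2 ≤ l / 200 × 200 * (l / 200) ≤ l × l < 200 * suc (l / 200)
l/200-bounds l 400≤l = /-monoˡ-≤ 200 400≤l , lower , upper
  where
  lower : 200 * (l / 200) ≤ l
  lower = ≤-trans (≤-reflexive (*-comm 200 (l / 200))) (m/n*n≤m l 200)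
  upper : l < 200 * suc (l / 200)
  upper = subst (_< 200 * suc (l / 200)) (sym (m≡m%n+[m/n]*n l 200))
            (subst (l % 200 + l / 200 * 200 <_) (*-comm (suc (l / 200)) 200) (+-monoˡ-< _ (m%n<n l 200)))

2*k*l≤L : ∀ k l L → 200 * k ≤ l → l ^ 2 ≤ 100 * L → 2 * k * l ≤ L
2*k*l≤L k l L 200k≤l l²≤100L = *-cancelˡ-≤ 100 (begin
  100 * (2 * k * l)  ≡⟨ *-assoc 100 (2 * k) l ⟨
  100 * (2 * k) * l  ≡⟨ cong (_* l) (*-assoc 100 2 k) ⟨
  200 * k * l        ≤⟨ *-monoˡ-≤ l 200k≤l ⟩
  l * l              ≡⟨ cong (l *_) (*-identityʳ l) ⟨
  l ^ 2              ≤⟨ l²≤100L ⟩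
  100 * L            ∎)
  where open ≤-Reasoning

[1+l]^2≤100*k*q : ∀ k l → 2 ≤ k → 200 * k ≤ l → l < 200 * suc k → suc l ^ 2 ≤ 100 * (k * (2 * l + 1000))
[1+l]^2≤100*k*q k l 2≤k 200k≤l l<200[1+k] = begin
  suc l ^ 2                          ≤⟨ ^-monoˡ-≤ 2 l<200[1+k] ⟩
  (200 * suc k) ^ 2                  ≤⟨ ∀-offset⇒∀-≥ {P} 2 square≤ 2≤k ⟩
  100 * (k * (2 * (200 * k) + 1000)) ≤⟨ *-monoʳ-≤ 100 (*-monoʳ-≤ k (+-monoˡ-≤ 1000 (*-monoʳ-≤ 2 200k≤l))) ⟩
  100 * (k * (2 * l + 1000))         ∎
  where
  open ≤-Reasoning
  P : ℕ → Set
  P k = (200 * suc k) ^ 2 ≤ 100 * (k * (2 * (200 * k) + 1000))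
  expand : ∀ h x → h * ((x + 2) * (2 * (2 * h * (x + 2)) + 10 * h))
                     ≡ (2 * h * (1 + (x + 2))) * ((2 * h * (1 + (x + 2))) * 1) + 2 * h * h * x
  expand = solve-∀
  square≤ : ∀ x → P (x + 2)
  square≤ x = ≤-trans (m≤m+n _ (2 * 100 * 100 * x)) (≤-reflexive (sym (expand 100 x)))

30l≤m : ∀ {l n m} (L : Fin m → ℕ) → 19 ≤ l → l ^ 3 ≤ n → sumFin m L ≡ n →
  (∀ j → 100 * L j < 3 * suc l ^ 2) → 30 * l ≤ m
30l≤m {l} {n} {m} L 19≤l l³≤n ΣL≡n 100L< =
  *-cancelʳ-≤ (30 * l) m (3 * suc l ^ 2) (begin
    30 * l * (3 * suc l ^ 2)   ≤⟨ ∀-offset⇒∀-≥ {P} 19 cube≥ 19≤l ⟩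
    100 * l ^ 3                ≤⟨ *-monoʳ-≤ 100 l³≤n ⟩
    100 * n                    ≡⟨ cong (100 *_) ΣL≡n ⟨
    100 * sumFin m L           ≡⟨ sumFin-*ˡ m 100 L ⟨
    sumFin m (λ j → 100 * L j) ≤⟨ sumFin-≤-* m (λ j → <⇒≤ (100L< j)) ⟩
    m * (3 * suc l ^ 2)        ∎)
  where
  open ≤-Reasoning
  P : ℕ → Set
  P l = 30 * l * (3 * suc l ^ 2) ≤ 100 * l ^ 3
  expand : ∀ x → 100 * ((x + 19) * ((x + 19) * ((x + 19) * 1)))
                   ≡ 30 * (x + 19) * (3 * ((1 + (x + 19)) * ((1 + (x + 19)) * 1)))
                     + (x + 19) * (10 * x * x + 200 * x + 100)
  expand = solve-∀
  cube≥ : ∀ x → P (x + 19)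
  cube≥ x = ≤-trans (m≤m+n _ ((x + 19) * (10 * x * x + 200 * x + 100))) (≤-reflexive (sym (expand x)))

[1+n]^3≤2*n^3 : ∀ {n} → 4 ≤ n → suc n ^ 3 ≤ 2 * n ^ 3
[1+n]^3≤2*n^3 = ∀-offset⇒∀-≥ {λ n → suc n ^ 3 ≤ 2 * n ^ 3} 4 λ x →
  ≤-trans (m≤m+n _ (x * x * x + 9 * (x * x) + 21 * x + 3)) (≤-reflexive (sym (expand x)))
  where
  expand : ∀ x → 2 * ((x + 4) * ((x + 4) * ((x + 4) * 1)))
                   ≡ (1 + (x + 4)) * ((1 + (x + 4)) * ((1 + (x + 4)) * 1)) + (x * x * x + 9 * (x * x) + 21 * x + 3)
  expand = solve-∀

[1+l]^3*c≤2^l-from : ∀ {K c} → 4 ≤ K → suc K ^ 3 * c ≤ 2 ^ K → ∀ {l} → K ≤ l → suc l ^ 3 * c ≤ 2 ^ l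
[1+l]^3*c≤2^l-from {K} {c} 4≤K base = ∀-offset⇒∀-≥ {λ l → suc l ^ 3 * c ≤ 2 ^ l} K step
  where
  step : ∀ x → suc (x + K) ^ 3 * c ≤ 2 ^ (x + K)
  step zero    = base
  step (suc x) = begin
    suc (suc y) ^ 3 * c    ≤⟨ *-monoˡ-≤ c ([1+n]^3≤2*n^3 (m≤n⇒m≤1+n (≤-trans 4≤K (m≤n+m K x)))) ⟩
    2 * suc y ^ 3 * c      ≡⟨ *-assoc 2 (suc y ^ 3) c ⟩
    2 * (suc y ^ 3 * c)    ≤⟨ *-monoʳ-≤ 2 (step x) ⟩
    2 * 2 ^ y              ∎
    where
    open ≤-Reasoning
    y = x + K

[1+l]^3*2^[2l+e]≤2^[3l] : ∀ {l e} → suc l ^ 3 * 2 ^ e ≤ 2 ^ l → suc l ^ 3 * 2 ^ (2 * l + e) ≤ 2 ^ (3 * l)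
[1+l]^3*2^[2l+e]≤2^[3l] {l} {e} small = begin
  suc l ^ 3 * 2 ^ (2 * l + e)       ≡⟨ cong (suc l ^ 3 *_) (^-distribˡ-+-* 2 (2 * l) e) ⟩
  suc l ^ 3 * (2 ^ (2 * l) * 2 ^ e) ≡⟨ *-left-comm (suc l ^ 3) (2 ^ (2 * l)) (2 ^ e) ⟩
  2 ^ (2 * l) * (suc l ^ 3 * 2 ^ e) ≤⟨ *-monoʳ-≤ (2 ^ (2 * l)) small ⟩
  2 ^ (2 * l) * 2 ^ l               ≡⟨ ^-distribˡ-+-* 2 (2 * l) l ⟨
  2 ^ (2 * l + l)                   ≡⟨ cong (2 ^_) (+-comm (2 * l) l) ⟩
  2 ^ (3 * l)                       ∎
  where open ≤-Reasoning

weighted-2^-cancel-< : ∀ c x y → x ≤ c → 0 < y → c * 2 ^ x < 2 ^ y → x < y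
weighted-2^-cancel-< zero    zero    y _  0<y _    = 0<y
weighted-2^-cancel-< zero    (suc x) y () _   _
weighted-2^-cancel-< (suc c) x       y _  _   c2ˣ< = ^-cancelʳ-< 2 (≤-<-trans (m≤m+n (2 ^ x) (c * 2 ^ x)) c2ˣ<)

[1+l]^3*2^1000≤2^l : ∀ {l} → 1100 ≤ l → suc l ^ 3 * 2 ^ 1000 ≤ 2 ^ l
[1+l]^3*2^1000≤2^l = [1+l]^3*c≤2^l-from {1100} {2 ^ 1000} (≤ᵇ⇒≤ 4 1100 tt) (≤ᵇ⇒≤ _ _ tt)

x<3l : ∀ {l n c x} → 1100 ≤ l → n < suc l ^ 3 → x ≤ c → c * 2 ^ x ≤ n * 2 ^ (2 * l + 1000) → x < 3 * l
x<3l {l} {n} {c} {x} 1100≤l n<[1+l]³ x≤c c2ˣ≤ = weighted-2^-cancel-< c x (3 * l) x≤c 0<3l (≤-<-trans c2ˣ≤ (begin-strict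
  n * 2 ^ (2 * l + 1000)          <⟨ *-monoˡ-< (2 ^ (2 * l + 1000)) {{m^n≢0 2 (2 * l + 1000)}} n<[1+l]³ ⟩
  suc l ^ 3 * 2 ^ (2 * l + 1000)  ≤⟨ [1+l]^3*2^[2l+e]≤2^[3l] {l} {1000} ([1+l]^3*2^1000≤2^l {l} 1100≤l) ⟩
  2 ^ (3 * l)                     ∎))
  where
  open ≤-Reasoning
  0<3l : 0 < 3 * l
  0<3l = ≤-trans (s≤s z≤n) (≤-trans 1100≤l (m≤m+n l (2 * l)))

[[1+l]^2]^3>n^2 : ∀ {l n} → n < suc l ^ 3 → n ^ 2 < (suc l ^ 2) ^ 3
[[1+l]^2]^3>n^2 {l} {n} n<[1+l]³ = subst (n ^ 2 <_) (sym ([x^2]^3≡[x^3]^2 (suc l))) (^-monoˡ-< 2 n<[1+l]³)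

l^2≤100L : ∀ {l n L} → l ^ 3 ≤ n → n ^ 2 ≤ (100 * L) ^ 3 → l ^ 2 ≤ 100 * L
l^2≤100L {l} {n} l³≤n n²≤ =
  ^-cancelˡ-≤ 3 (≤-trans (subst (_≤ n ^ 2) (sym ([x^2]^3≡[x^3]^2 l)) (^-monoˡ-≤ 2 l³≤n)) n²≤)

100L<3[1+l]^2 : ∀ {l n L} → n < suc l ^ 3 → (100 * L) ^ 3 ≤ 27 * n ^ 2 → 100 * L < 3 * suc l ^ 2
100L<3[1+l]^2 {l} {n} {L} n<[1+l]³ ≤27n² = ^-cancelˡ-< 3 {100 * L} {3 * suc l ^ 2}
  (subst ((100 * L) ^ 3 <_) (sym (^-distribʳ-* 3 (suc l ^ 2) 3))
         (≤-<-trans ≤27n² (*-monoʳ-< 27 ([[1+l]^2]^3>n^2 {l} {n} n<[1+l]³))))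

100c<[1+l]^2 : ∀ {l n c} → n < suc l ^ 3 → (100 * c) ^ 3 ≤ n ^ 2 → 100 * c < suc l ^ 2
100c<[1+l]^2 {l} {n} {c} n<[1+l]³ ≤n² =
  ^-cancelˡ-< 3 {100 * c} {suc l ^ 2} (≤-<-trans ≤n² ([[1+l]^2]^3>n^2 {l} {n} n<[1+l]³))

mainTheorem9 : ∃ λ (N : ℕ) → ∀ (n : ℕ) → N ≤ n →
    ∀ (l : ℕ) → l ^ 3 ≤ n → n < suc l ^ 3 →
    ∀ (a : ℕ) → 1 ≤ a →
    ∀ (m : ℕ) (stacks : Fin m → Stack a) →
    sumFin m (λ j → length (stacks j)) ≡ n →
    (∀ (j : Fin m) →
    n ^ 2 ≤ (100 * length (stacks j)) ^ 3
    × (100 * length (stacks j)) ^ 3 ≤ 27 * n ^ 2) →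
    (∀ (i : Fin a) → (100 * sumFin m (λ j → countLabel i (stacks j))) ^ 3 ≤ n ^ 2) →
    Σ ((j : Fin m) → SubstackChoice l (stacks j)) λ choice →
    ∀ (i : Fin a) →
    10 * countFin m (λ j → hasLabel i (substack (proj₁ (choice j)) l (stacks j))) < m
mainTheorem9 = 1100 ^ 3 , λ n 1100³≤n l l³≤n n<[1+l]³ a _ m stacks size≡n sizes totals →
  let k = l / 200
      q = 2 * l + 1000
      1100≤l = ≤-pred (^-cancelˡ-< 3 {1100} {suc l} (≤-<-trans 1100³≤n n<[1+l]³))
      2≤k , 200k≤l , l<200[1+k] = l/200-bounds l (≤-trans (≤ᵇ⇒≤ 400 1100 tt) 1100≤l)
      instance k≢0 = >-nonZero (≤-trans (s≤s z≤n) 2≤k)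
      L = λ j → length (stacks j)
      blocks-fit = λ j → 2*k*l≤L k l (L j) 200k≤l (l^2≤100L {l} {n} {L j} l³≤n (proj₁ (sizes j)))
      totals≤kq = λ i → *-cancelˡ-≤ 100 (<⇒≤ (<-≤-trans
                    (100c<[1+l]^2 {l} {n} {labelTotal stacks i} n<[1+l]³ (totals i))
                    ([1+l]^2≤100*k*q k l 2≤k 200k≤l l<200[1+k])))
      choice , few = ∃-substacks-with-few-hits l k q stacks size≡n blocks-fit totals≤kq
      hits<3l = λ i → x<3l {l} {n} {labelTotal stacks i} {hits l stacks choice i} 1100≤l n<[1+l]³
                             (hits≤labelTotal l stacks choice i) (few i)
      30l≤m′ = 30l≤m {l} {n} {m} L (≤-trans (≤ᵇ⇒≤ 19 1100 tt) 1100≤l) l³≤n size≡n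
                 (λ j → 100L<3[1+l]^2 {l} {n} {L j} n<[1+l]³ (proj₂ (sizes j)))
  in choice , λ i → <-≤-trans (*-monoʳ-< 10 (hits<3l i)) (≤-trans (≤-reflexive (sym (*-assoc 10 3 l))) 30l≤m′)
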